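{- Let $\mathcal E$ be a category with finite limits and terminal object $1$, let $(\mathsf P,\mu,\eta)$ be a cartesian monad on $\mathcal E$ equipped with a strength $D$, and let $u\colon\mathsf P1\to1$ be the unique morphism. Then for every object $A$ of $\mathcal E$ the square $$\begin{array}{ccc} A\times\mathsf P^21 & \xrightarrow{A\times\mathsf Pu} & A\times\mathsf P1\\ \downarrow{\scriptstyle D_{A,\mathsf P1}} & & \downarrow{\scriptstyle D_{A,1}}\\ \mathsf P(A\times\mathsf P1) & \xrightarrow{\mathsf P(A\times u)} & \mathsf P(A\times1)\end{array}$$ is a pullback.
   Context: A monad $(\mathsf P,\mu,\eta)$ is cartesian if $\mathsf P$ preserves pullbacks and the naturality squares of $\mu$ and $\eta$ are pullbacks. A strength for $\mathsf P$ is a natural transformation $D_{A,B}\colon A\times\mathsf PB\to\mathsf P(A\times B)$ such that: $\mathsf P(p_2)\circ D_{1,A}=p_2\colon1\times\mathsf PA\to\mathsf PA$; $D$ is compatible with the associativity isomorphisms of $\times$, i.e. $D_{A,B\times C}\circ(A\times D_{B,C})\circ\alpha=\mathsf P(\alpha)\circ D_{A\times B,C}$ as maps $(A\times B)\times\mathsf PC\to\mathsf P(A\times(B\times C))$; $D_{A,B}\circ(A\times\eta_B)=\eta_{A\times B}$; and $\mu_{A\times B}\circ\mathsf PD_{A,B}\circ D_{A,\mathsf PB}=D_{A,B}\circ(A\times\mu_B)$. -}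

module Defs where

open import Level using (Level; _⊔_; suc)
open import Data.Product using (Σ; _×_; _,_)
open import Relation.Binary using (IsEquivalence)

record Category (o ℓ e : Level) : Set (suc (o ⊔ ℓ ⊔ e)) where
  infixr 9 _∘_
  infix 4 _≈_
  field
    Obj : Set o
    Hom : Obj → Obj → Set ℓ
    _≈_ : ∀ {A B} → Hom A B → Hom A B → Set e
    id  : ∀ {A} → Hom A A
    _∘_ : ∀ {A B C} → Hom B C → Hom A B → Hom A C
    ≈-equiv : ∀ {A B} → IsEquivalence (_≈_ {A} {B})
    ∘-resp-≈ : ∀ {A B C} {f h : Hom B C} {g i : Hom A B} →
               f ≈ h → g ≈ i → f ∘ g ≈ h ∘ i
    assoc : ∀ {A B C D} {f : Hom A B} {g : Hom B C} {h : Hom C D} →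
            (h ∘ g) ∘ f ≈ h ∘ (g ∘ f)
    identityˡ : ∀ {A B} {f : Hom A B} → id ∘ f ≈ f
    identityʳ : ∀ {A B} {f : Hom A B} → f ∘ id ≈ f

module _ {o ℓ e : Level} (C : Category o ℓ e) where
  open Category C

  record IsPullback {P A B C' : Obj} (f : Hom A C') (g : Hom B C')
                    (p₁ : Hom P A) (p₂ : Hom P B) : Set (o ⊔ ℓ ⊔ e) where
    field
      commute   : f ∘ p₁ ≈ g ∘ p₂
      universal : ∀ {X} (h₁ : Hom X A) (h₂ : Hom X B) → f ∘ h₁ ≈ g ∘ h₂ →
                  Σ (Hom X P) λ k → (p₁ ∘ k ≈ h₁) × (p₂ ∘ k ≈ h₂)
      unique    : ∀ {X} (k k′ : Hom X P) →
                  p₁ ∘ k ≈ p₁ ∘ k′ → p₂ ∘ k ≈ p₂ ∘ k′ → k ≈ k′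

  record Pullback {A B C' : Obj} (f : Hom A C') (g : Hom B C') : Set (o ⊔ ℓ ⊔ e) where
    field
      P  : Obj
      p₁ : Hom P A
      p₂ : Hom P B
      isPullback : IsPullback f g p₁ p₂

  record Terminal : Set (o ⊔ ℓ ⊔ e) where
    field
      ⊤ : Obj
      ! : ∀ {A} → Hom A ⊤
      !-unique : ∀ {A} (f : Hom A ⊤) → f ≈ !

  record BinaryProducts : Set (o ⊔ ℓ ⊔ e) where
    infixr 7 _×₀_
    field
      _×₀_ : Obj → Obj → Obj
      π₁ : ∀ {A B} → Hom (A ×₀ B) A
      π₂ : ∀ {A B} → Hom (A ×₀ B) B
      ⟨_,_⟩ : ∀ {X A B} → Hom X A → Hom X B → Hom X (A ×₀ B)
      project₁ : ∀ {X A B} {f : Hom X A} {g : Hom X B} → π₁ ∘ ⟨ f , g ⟩ ≈ f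
      project₂ : ∀ {X A B} {f : Hom X A} {g : Hom X B} → π₂ ∘ ⟨ f , g ⟩ ≈ g
      unique   : ∀ {X A B} {h : Hom X (A ×₀ B)} {f : Hom X A} {g : Hom X B} →
                 π₁ ∘ h ≈ f → π₂ ∘ h ≈ g → ⟨ f , g ⟩ ≈ h

    _⁂_ : ∀ {A B A′ B′} → Hom A A′ → Hom B B′ → Hom (A ×₀ B) (A′ ×₀ B′)
    f ⁂ g = ⟨ f ∘ π₁ , g ∘ π₂ ⟩

    assocʳ : ∀ {A B C'} → Hom ((A ×₀ B) ×₀ C') (A ×₀ (B ×₀ C'))
    assocʳ = ⟨ π₁ ∘ π₁ , ⟨ π₂ ∘ π₁ , π₂ ⟩ ⟩

  record FiniteLimits : Set (o ⊔ ℓ ⊔ e) where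
    field
      terminal : Terminal
      products : BinaryProducts
      pullback : ∀ {A B C'} (f : Hom A C') (g : Hom B C') → Pullback f g
    open Terminal terminal public
    open BinaryProducts products public

module _ {o ℓ e o′ ℓ′ e′ : Level} where
  record Functor (C : Category o ℓ e) (D : Category o′ ℓ′ e′)
         : Set (o ⊔ ℓ ⊔ e ⊔ o′ ⊔ ℓ′ ⊔ e′) where
    private
      module C = Category C
      module D = Category D
    field
      F₀ : C.Obj → D.Obj
      F₁ : ∀ {A B} → C.Hom A B → D.Hom (F₀ A) (F₀ B)
      identity : ∀ {A} → F₁ (C.id {A}) D.≈ D.id
      homomorphism : ∀ {A B C'} {f : C.Hom A B} {g : C.Hom B C'} →
                     F₁ (g C.∘ f) D.≈ F₁ g D.∘ F₁ f
      F-resp-≈ : ∀ {A B} {f g : C.Hom A B} → f C.≈ g → F₁ f D.≈ F₁ g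

module _ {o ℓ e : Level} (C : Category o ℓ e) where
  open Category C

  record Monad : Set (o ⊔ ℓ ⊔ e) where
    field
      F : Functor C C
    open Functor F public
    field
      η : ∀ A → Hom A (F₀ A)
      μ : ∀ A → Hom (F₀ (F₀ A)) (F₀ A)
      η-natural : ∀ {A B} (f : Hom A B) → η B ∘ f ≈ F₁ f ∘ η A
      μ-natural : ∀ {A B} (f : Hom A B) → μ B ∘ F₁ (F₁ f) ≈ F₁ f ∘ μ A
      assoc    : ∀ {A} → μ A ∘ F₁ (μ A) ≈ μ A ∘ μ (F₀ A)
      identityˡ : ∀ {A} → μ A ∘ F₁ (η A) ≈ id
      identityʳ : ∀ {A} → μ A ∘ η (F₀ A) ≈ id

  record IsCartesian (M : Monad) : Set (o ⊔ ℓ ⊔ e) where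
    open Monad M
    field
      preserves-pullbacks :
        ∀ {P A B C'} {f : Hom A C'} {g : Hom B C'} {p₁ : Hom P A} {p₂ : Hom P B} →
        IsPullback C f g p₁ p₂ → IsPullback C (F₁ f) (F₁ g) (F₁ p₁) (F₁ p₂)
      μ-cartesian : ∀ {A B} (f : Hom A B) →
        IsPullback C (F₁ f) (μ B) (μ A) (F₁ (F₁ f))
      η-cartesian : ∀ {A B} (f : Hom A B) →
        IsPullback C (F₁ f) (η B) (η A) f

  record Strength (L : FiniteLimits C) (M : Monad) : Set (o ⊔ ℓ ⊔ e) where
    open FiniteLimits L
    open Monad M
    field
      D : ∀ A B → Hom (A ×₀ F₀ B) (F₀ (A ×₀ B))
      natural : ∀ {A A′ B B′} (f : Hom A A′) (g : Hom B B′) →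
                D A′ B′ ∘ (f ⁂ F₁ g) ≈ F₁ (f ⁂ g) ∘ D A B
      unit-left : ∀ {A} → F₁ π₂ ∘ D ⊤ A ≈ π₂
      strength-assoc : ∀ {A B C'} →
        D A (B ×₀ C') ∘ ((id ⁂ D B C') ∘ assocʳ) ≈ F₁ assocʳ ∘ D (A ×₀ B) C'
      strength-η : ∀ {A B} → D A B ∘ (id ⁂ η B) ≈ η (A ×₀ B)
      strength-μ : ∀ {A B} →
        μ (A ×₀ B) ∘ (F₁ (D A B) ∘ D A (F₀ B)) ≈ D A B ∘ (id ⁂ μ B)

{-# OPTIONS --safe #-}
module Submission where

-- Composing the strength with Pπ₂ gives the projection π₂, so the square sits to
-- the left of the P-image of the pullback square
--     A × P1 --π₂--> P1
--       | id × u      | u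
--     A × 1 ---π₂--> 1
-- and together they form the product square A × P²1 → A × P1 over Pu: P²1 → P1,
-- which is a pullback. The pasting lemma then makes the left square a pullback.

open import Level using (Level)
open import Data.Product using (_,_)
open import Relation.Binary using (IsEquivalence; Setoid)
import Relation.Binary.Reasoning.Setoid as SetoidReasoning
open import Defs

module CategoryProperties {o ℓ e : Level} (C : Category o ℓ e) where
  open Category C
  module ≈ {A B : Obj} = IsEquivalence (≈-equiv {A} {B})
  open ≈ public

  hom-setoid : Obj → Obj → Setoid ℓ e
  hom-setoid A B = record { Carrier = Hom A B ; _≈_ = _≈_ ; isEquivalence = ≈-equiv }

  module HomReasoning {A B : Obj} = SetoidReasoning (hom-setoid A B)

  ∘-resp-≈ˡ : ∀ {A B C'} {f h : Hom B C'} {g : Hom A B} → f ≈ h → f ∘ g ≈ h ∘ g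
  ∘-resp-≈ˡ p = ∘-resp-≈ p refl

  ∘-resp-≈ʳ : ∀ {A B C'} {f : Hom B C'} {g i : Hom A B} → g ≈ i → f ∘ g ≈ f ∘ i
  ∘-resp-≈ʳ p = ∘-resp-≈ refl p

  IsPullback-resp-≈ :
    ∀ {P A B C'} {f f′ : Hom A C'} {g g′ : Hom B C'} {p₁ p₁′ : Hom P A} {p₂ p₂′ : Hom P B} →
    f ≈ f′ → g ≈ g′ → p₁ ≈ p₁′ → p₂ ≈ p₂′ →
    IsPullback C f g p₁ p₂ → IsPullback C f′ g′ p₁′ p₂′
  IsPullback-resp-≈ f≈ g≈ p₁≈ p₂≈ pb = record
    { commute   = trans (∘-resp-≈ (sym f≈) (sym p₁≈))
                        (trans commute (∘-resp-≈ g≈ p₂≈))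
    ; universal = λ h₁ h₂ eq →
        let k , p₁k , p₂k = universal h₁ h₂
                              (trans (∘-resp-≈ˡ f≈) (trans eq (∘-resp-≈ˡ (sym g≈))))
        in k , trans (∘-resp-≈ˡ (sym p₁≈)) p₁k , trans (∘-resp-≈ˡ (sym p₂≈)) p₂k
    ; unique    = λ k k′ p q → unique k k′
        (trans (∘-resp-≈ˡ p₁≈) (trans p (∘-resp-≈ˡ (sym p₁≈))))
        (trans (∘-resp-≈ˡ p₂≈) (trans q (∘-resp-≈ˡ (sym p₂≈))))
    }
    where open IsPullback pb

  -- Left square (a′, y, x, a), right square (b′, z, y, b):
  --     X  --a-->  Y  --b-->  Z
  --     |x         |y         |z
  --     X′ --a′--> Y′ --b′--> Z′
  pullback-pasteˡ :
    ∀ {X Y Z X′ Y′ Z′} {a : Hom X Y} {b : Hom Y Z} {a′ : Hom X′ Y′} {b′ : Hom Y′ Z′}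
      {x : Hom X X′} {y : Hom Y Y′} {z : Hom Z Z′} →
    a′ ∘ x ≈ y ∘ a →
    IsPullback C b′ z y b →
    IsPullback C (b′ ∘ a′) z x (b ∘ a) →
    IsPullback C a′ y x a
  pullback-pasteˡ {a = a} {b} {a′} {b′} {x} {y} {z} left-commute right outer = record
    { commute   = left-commute
    ; universal = λ h₁ h₂ eq →
        let k , xk , bak = outer.universal h₁ (b ∘ h₂) (begin
              (b′ ∘ a′) ∘ h₁ ≈⟨ assoc ⟩
              b′ ∘ (a′ ∘ h₁) ≈⟨ ∘-resp-≈ʳ eq ⟩
              b′ ∘ (y ∘ h₂)  ≈⟨ sym assoc ⟩
              (b′ ∘ y) ∘ h₂  ≈⟨ ∘-resp-≈ˡ right.commute ⟩
              (z ∘ b) ∘ h₂   ≈⟨ assoc ⟩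
              z ∘ (b ∘ h₂)   ∎)
            ak = right.unique (a ∘ k) h₂
              (begin
                y ∘ (a ∘ k)  ≈⟨ sym assoc ⟩
                (y ∘ a) ∘ k  ≈⟨ ∘-resp-≈ˡ (sym left-commute) ⟩
                (a′ ∘ x) ∘ k ≈⟨ assoc ⟩
                a′ ∘ (x ∘ k) ≈⟨ ∘-resp-≈ʳ xk ⟩
                a′ ∘ h₁      ≈⟨ eq ⟩
                y ∘ h₂       ∎)
              (trans (sym assoc) bak)
        in k , xk , ak
    ; unique    = λ k k′ p q →
        outer.unique k k′ p (trans assoc (trans (∘-resp-≈ʳ q) (sym assoc)))
    }
    where
    module right = IsPullback right
    module outer = IsPullback outer
    open HomReasoning

module ProductProperties {o ℓ e : Level} (C : Category o ℓ e) (P : BinaryProducts C) where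
  open Category C
  open BinaryProducts P renaming (unique to ⟨⟩-unique)
  open CategoryProperties C

  ⟨π₁,π₂⟩∘ : ∀ {X A B} {h : Hom X (A ×₀ B)} → ⟨ π₁ ∘ h , π₂ ∘ h ⟩ ≈ h
  ⟨π₁,π₂⟩∘ = ⟨⟩-unique refl refl

  ×-ext : ∀ {X A B} {k k′ : Hom X (A ×₀ B)} → π₁ ∘ k ≈ π₁ ∘ k′ → π₂ ∘ k ≈ π₂ ∘ k′ → k ≈ k′
  ×-ext p q = trans (sym ⟨π₁,π₂⟩∘) (⟨⟩-unique (sym p) (sym q))

  π₁∘⁂∘ : ∀ {X A B A′ B′} {f : Hom A A′} {g : Hom B B′} {k : Hom X (A ×₀ B)} →
          π₁ ∘ ((f ⁂ g) ∘ k) ≈ f ∘ (π₁ ∘ k)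
  π₁∘⁂∘ = trans (sym assoc) (trans (∘-resp-≈ˡ project₁) assoc)

  π₂∘⁂∘ : ∀ {X A B A′ B′} {f : Hom A A′} {g : Hom B B′} {k : Hom X (A ×₀ B)} →
          π₂ ∘ ((f ⁂ g) ∘ k) ≈ g ∘ (π₂ ∘ k)
  π₂∘⁂∘ = trans (sym assoc) (trans (∘-resp-≈ˡ project₂) assoc)

  id⁂-pullback : ∀ {A X Y} (f : Hom X Y) → IsPullback C (π₂ {A}) f (id ⁂ f) π₂
  id⁂-pullback f = record
    { commute   = project₂
    ; universal = λ h₁ h₂ eq →
        ⟨ π₁ ∘ h₁ , h₂ ⟩
        , ×-ext (trans π₁∘⁂∘ (trans identityˡ project₁))
                (trans π₂∘⁂∘ (trans (∘-resp-≈ʳ project₂) (sym eq)))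
        , project₂
    ; unique    = λ k k′ p q → ×-ext
        (trans (sym identityˡ) (trans (sym π₁∘⁂∘) (trans (∘-resp-≈ʳ p)
          (trans π₁∘⁂∘ identityˡ))))
        q
    }

module StrengthProperties {o ℓ e : Level} {C : Category o ℓ e} {L : FiniteLimits C}
                          {M : Monad C} (S : Strength C L M) where
  open Category C
  open FiniteLimits L
  open Monad M hiding (assoc; identityˡ; identityʳ)
  open Strength S
  open CategoryProperties C

  -- Reduce to the unit law by naturality of D in the first variable along !.
  F₁π₂∘D : ∀ {A B} → F₁ π₂ ∘ D A B ≈ π₂
  F₁π₂∘D {A} {B} = begin
    F₁ π₂ ∘ D A B                  ≈⟨ ∘-resp-≈ˡ (F-resp-≈ (sym (trans project₂ identityˡ))) ⟩
    F₁ (π₂ ∘ (! ⁂ id)) ∘ D A B     ≈⟨ ∘-resp-≈ˡ homomorphism ⟩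
    (F₁ π₂ ∘ F₁ (! ⁂ id)) ∘ D A B  ≈⟨ assoc ⟩
    F₁ π₂ ∘ (F₁ (! ⁂ id) ∘ D A B)  ≈⟨ ∘-resp-≈ʳ (sym (natural ! id)) ⟩
    F₁ π₂ ∘ (D ⊤ B ∘ (! ⁂ F₁ id))  ≈⟨ sym assoc ⟩
    (F₁ π₂ ∘ D ⊤ B) ∘ (! ⁂ F₁ id)  ≈⟨ ∘-resp-≈ˡ unit-left ⟩
    π₂ ∘ (! ⁂ F₁ id)               ≈⟨ project₂ ⟩
    F₁ id ∘ π₂                     ≈⟨ ∘-resp-≈ˡ identity ⟩
    id ∘ π₂                        ≈⟨ identityˡ ⟩
    π₂                             ∎
    where open HomReasoning

lemma1p6 : ∀ {o ℓ e : Level} (C : Category o ℓ e) (L : FiniteLimits C)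
             (M : Monad C) → IsCartesian C M → (S : Strength C L M) →
             let open Category C
                 open FiniteLimits L
                 open Monad M
                 open Strength S
                 u : Hom (F₀ ⊤) ⊤
                 u = !
             in ∀ (A : Obj) →
                IsPullback C (D A ⊤) (F₁ (id {A} ⁂ u))
                             (id {A} ⁂ F₁ u) (D A (F₀ ⊤))
lemma1p6 C L M cart S A =
  pullback-pasteˡ (natural id !)
    (preserves-pullbacks (id⁂-pullback !))
    (IsPullback-resp-≈ (sym F₁π₂∘D) refl refl (sym F₁π₂∘D) (id⁂-pullback (F₁ !)))
  where
  open Category C
  open FiniteLimits L
  open Monad M
  open Strength S
  open IsCartesian cart
  open CategoryProperties C
  open ProductProperties C products
  open StrengthProperties S
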